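{- For all integers $n,m\geq 0$, the following hold (the second in the field of rational functions in $t_1,t_2,\dots$): \[ \sum_{k=0}^{n}(-1)^{n-k}\binom{n}{k}A_{n+m,m+k}(\mathbf{t}) = \mathcal{Y}_{m}(\mathbf{t})\,t_1^{n+1},\qquad \sum_{k=0}^{n}\binom{n}{k}A_{m+k,m}(\mathbf{t})\,t_1^{n-k-1} = \mathcal{Y}_{m+n}(\mathbf{t}). \]
   Context: $t_1,t_2,\dots$ are indeterminates. For a set partition $\pi$ assign each block of size $j$ the weight $t_j$, and let $w(\pi)$ be the product of its block weights. $\mathcal{Y}_n(\mathbf{t})$ is the sum of $w(\pi)$ over all partitions $\pi$ of $[n]=\{1,\dots,n\}$ ($\mathcal{Y}_0=1$). For $0\le k\le n$, $A_{n,k}(\mathbf{t})$ is the sum of $w(\pi)$ over all partitions of $[n+1]$ whose largest singleton block is $\{k+1\}$ (i.e. $\{k+1\}$ is a block and no $\{i\}$ with $i>k+1$ is a block). -}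

module Defs where

open import Data.Nat using (ℕ; zero; suc; _∸_; _≡ᵇ_; _≤ᵇ_)
open import Data.Bool using (Bool; true; false; _∧_)
open import Data.List using (List; []; _∷_; [_]; map; concatMap; filter; upTo)
open import Data.Bool.ListAction using (any; all)
open import Data.Maybe using (Maybe; just; nothing)
open import Data.Nat.Combinatorics using (_C_)
open import Algebra.Bundles using (CommutativeRing)
open import Relation.Nullary.Decidable using (yes; no)
open import Relation.Binary.PropositionalEquality using (_≡_)
open import Data.Bool.Properties using () renaming (_≟_ to _≟ᵇ_)

-- A set partition is represented as a list of blocks, each block a list of
-- elements of {1,...,n}.
Partition : Set
Partition = List (List ℕ)

extend : ℕ → Partition → List Partition
extend x [] = [ [ [ x ] ] ]
extend x (b ∷ bs) = ((x ∷ b) ∷ bs) ∷ map (b ∷_) (extend x bs)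

partitions : ℕ → List Partition
partitions zero = [ [] ]
partitions (suc n) = concatMap (extend (suc n)) (partitions n)

singletonElt : List ℕ → Maybe ℕ
singletonElt (x ∷ []) = just x
singletonElt _ = nothing

isSingletonOf : ℕ → List ℕ → Bool
isSingletonOf j b with singletonElt b
... | just x = x ≡ᵇ j
... | nothing = false

singletonAtMost : ℕ → List ℕ → Bool
singletonAtMost j b with singletonElt b
... | just x = x ≤ᵇ j
... | nothing = true

largestSingletonIs : ℕ → Partition → Bool
largestSingletonIs j π = any (isSingletonOf j) π ∧ all (singletonAtMost j) π

module WithRing {c ℓ} (R : CommutativeRing c ℓ) where
  open CommutativeRing R

  sumR : List Carrier → Carrier
  sumR [] = 0#
  sumR (x ∷ xs) = x + sumR xs

  prodR : List Carrier → Carrier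
  prodR [] = 1#
  prodR (x ∷ xs) = x * prodR xs

  pow : Carrier → ℕ → Carrier
  pow x zero = 1#
  pow x (suc n) = x * pow x n

  nat· : ℕ → Carrier → Carrier
  nat· zero x = 0#
  nat· (suc n) x = x + nat· n x

  sumTo : ℕ → (ℕ → Carrier) → Carrier
  sumTo n f = sumR (map f (upTo (suc n)))

  module _ (t : ℕ → Carrier) where
    weight : Partition → Carrier
    weight π = prodR (map (λ b → t (Data.List.length b)) π)

    Y : ℕ → Carrier
    Y n = sumR (map weight (partitions n))

    A : ℕ → ℕ → Carrier
    A n k = sumR (map weight (filter (λ π → largestSingletonIs (suc k) π ≟ᵇ true) (partitions (suc n))))

module Submission where

-- Write B r k = A_{r+k,k}: the weighted sum over partitions of [r+k+1] whose
-- largest singleton block is {k+1}.  The corollary rests on two facts: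
--
--   (diagonal)    B 0 k = t₁ · Y_k,
--   (recurrence)  B (r+1) k = B r (k+1) − t₁ · B r k.
--
-- With the shift S (S B r k = B r (k+1)) the recurrence says B r = (S − t₁)^r B 0,
-- so both identities are binomial expansions:
--   Σ C(n,k) (−1)^{n−k} S^k (S − t₁)^{n−k} = t₁^n,   Σ C(n,k) (S − t₁)^k t₁^{n−k} = S^n.
--
-- Module PartitionSums (on top of
-- the list sums of ListSums) uses the list encoding of Defs, in which a
-- partition of [N+r] arises from one of [N] by inserting N+1, ..., N+r one at
-- a time.  Summing over these insertions ("extension sums") it shows
-- B r k = t₁ · Q r k, where Q r k is an inclusion–exclusion sum over the
-- extensions of partitions of [k] by r elements none of which may end as a
-- singleton; the defining recursion of Q is the recurrence above, and Q 0 k = Y_k.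

open import Defs
open import Data.Nat using (ℕ; _∸_) renaming (_+_ to _+ℕ_)
open import Data.Nat.Combinatorics using (_C_)
open import Data.Product using (_×_)
open import Algebra.Bundles using (CommutativeRing)

open import Data.Nat.Base using (zero; suc; _≤_; _<_; z≤n; s≤s; _≤ᵇ_; _≡ᵇ_)
import Data.Nat.Properties as ℕP
import Data.Nat.Combinatorics as ℕC
open import Data.Nat.Properties using (_≟_; _≤?_)
open import Data.Product using (_,_)
open import Data.Bool.Base using (Bool; true; false; _∧_; _∨_; if_then_else_; T)
open import Data.Bool.ListAction using (any; all)
open import Data.Bool.Properties using (∧-isCommutativeMonoid; ∨-isCommutativeMonoid; T-≡) renaming (_≟_ to _≟ᵇ_)
open import Data.Unit.Base using (tt)
open import Data.List.Base using (List; []; _∷_; [_]; map; concatMap; filter; applyUpTo; _++_; length; foldr)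
open import Data.List.Relation.Unary.All as All using (All; []; _∷_)
import Data.List.Relation.Unary.All.Properties as AllP
open import Data.List.Relation.Binary.Permutation.Propositional as Perm using (_↭_; ↭⇒↭ₛ′)
import Data.List.Relation.Binary.Permutation.Propositional.Properties as PermP
import Data.List.Relation.Binary.Permutation.Setoid.Properties as PermₛP
import Data.List.Properties as ListP
import Relation.Binary.PropositionalEquality as P
open P using (_≡_; _≢_)
open import Relation.Nullary.Decidable using (dec-true; dec-false)
open import Function.Bundles using (Equivalence)

and-↭ : ∀ {A : Set} (p : A → Bool) {xs ys : List A} → xs ↭ ys → all p xs ≡ all p ys
and-↭ p q = PermₛP.foldr-commMonoid (P.setoid Bool) ∧-isCommutativeMonoid
              (↭⇒↭ₛ′ P.isEquivalence (PermP.map⁺ p q))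

or-↭ : ∀ {A : Set} (p : A → Bool) {xs ys : List A} → xs ↭ ys → any p xs ≡ any p ys
or-↭ p q = PermₛP.foldr-commMonoid (P.setoid Bool) ∨-isCommutativeMonoid
             (↭⇒↭ₛ′ P.isEquivalence (PermP.map⁺ p q))

∨-false : ∀ a b → a ∨ b ≡ false → (a ≡ false) × (b ≡ false)
∨-false false b e = P.refl , e

T⇒≡true : ∀ {b} → T b → b ≡ true
T⇒≡true = Equivalence.to T-≡

≡ᵇ-false : ∀ {y j} → y ≢ j → (y ≡ᵇ j) ≡ false
≡ᵇ-false {y} {j} = dec-false (y ≟ j)

≡ᵇ-above : ∀ j y → j < y → (y ≡ᵇ j) ≡ false
≡ᵇ-above j y j<y = ≡ᵇ-false (P.≢-sym (ℕP.<⇒≢ j<y))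

≤ᵇ-above : ∀ j y → j < y → (y ≤ᵇ j) ≡ false
≤ᵇ-above j y j<y = dec-false (y ≤? j) (ℕP.<⇒≱ j<y)

-- All blocks of a partition of [k] are fine below k (Fine-partitions);
-- this invariant tells which singleton blocks the conditions in A can see.
fineBlock : ℕ → List ℕ → Bool
fineBlock k [] = false
fineBlock k (z ∷ []) = z ≤ᵇ k
fineBlock k (_ ∷ _ ∷ _) = true

Fine : ℕ → Partition → Set
Fine k π = All (λ b → T (fineBlock k b)) π

fineBlock-suc : ∀ k b → T (fineBlock k b) → T (fineBlock (suc k) b)
fineBlock-suc k (z ∷ []) h = ℕP.≤⇒≤ᵇ (ℕP.m≤n⇒m≤1+n (ℕP.≤ᵇ⇒≤ z k h))
fineBlock-suc k (_ ∷ _ ∷ _) h = tt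

fineBlock⇒atMost : ∀ k b → T (fineBlock k b) → singletonAtMost k b ≡ true
fineBlock⇒atMost k (z ∷ []) h = T⇒≡true h
fineBlock⇒atMost k (_ ∷ _ ∷ _) h = P.refl

fineBlock⇒notSuc : ∀ k b → T (fineBlock k b) → isSingletonOf (suc k) b ≡ false
fineBlock⇒notSuc k (z ∷ []) h = ≡ᵇ-false (ℕP.<⇒≢ (s≤s (ℕP.≤ᵇ⇒≤ z k h)))
fineBlock⇒notSuc k (_ ∷ _ ∷ _) h = P.refl

singletonOf⇒atMost : ∀ j b → isSingletonOf j b ≡ true → singletonAtMost j b ≡ true
singletonOf⇒atMost j (z ∷ []) e =
  dec-true (z ≤? j) (ℕP.≤-reflexive (ℕP.≡ᵇ⇒≡ z j (P.subst T (P.sym e) tt)))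
singletonOf⇒atMost j (_ ∷ _ ∷ _) ()

joins : ℕ → Partition → List Partition
joins x [] = []
joins x (b ∷ bs) = ((x ∷ b) ∷ bs) ∷ map (b ∷_) (joins x bs)

extend-split : ∀ x τ → extend x τ ≡ joins x τ ++ [ τ ++ [ [ x ] ] ]
extend-split x [] = P.refl
extend-split x (b ∷ bs) = P.cong (((x ∷ b) ∷ bs) ∷_)
  (P.trans (P.cong (map (b ∷_)) (extend-split x bs)) (ListP.map-++ (b ∷_) (joins x bs) _))

Fine⇒allAtMost : ∀ k π → Fine k π → all (singletonAtMost k) π ≡ true
Fine⇒allAtMost k [] [] = P.refl
Fine⇒allAtMost k (b ∷ π) (h ∷ hs) = P.cong₂ _∧_ (fineBlock⇒atMost k b h) (Fine⇒allAtMost k π hs)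

NoSingleton : ℕ → Partition → Set
NoSingleton j ρ = any (isSingletonOf j) ρ ≡ false

Fine⇒noSuc : ∀ k π → Fine k π → NoSingleton (suc k) π
Fine⇒noSuc k [] [] = P.refl
Fine⇒noSuc k (b ∷ π) (h ∷ hs) = P.cong₂ _∨_ (fineBlock⇒notSuc k b h) (Fine⇒noSuc k π hs)

Fine-extend : ∀ k π → Fine k π → All (Fine (suc k)) (extend (suc k) π)
Fine-extend k [] [] = (ℕP.≤⇒≤ᵇ (ℕP.≤-refl {suc k}) ∷ []) ∷ []
Fine-extend k ((z ∷ zs) ∷ π) (h ∷ hs) =
  (tt ∷ All.map (λ {b} → fineBlock-suc k b) hs) ∷
  AllP.map⁺ (All.map (λ f → fineBlock-suc k (z ∷ zs) h ∷ f) (Fine-extend k π hs))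

Fine-partitions : ∀ k → All (Fine k) (partitions k)
Fine-partitions zero = [] ∷ []
Fine-partitions (suc k) = AllP.concat⁺ (AllP.map⁺ (All.map (Fine-extend k _) (Fine-partitions k)))

Fine-joins : ∀ j x τ → Fine j τ → All (Fine j) (joins x τ)
Fine-joins j x [] [] = []
Fine-joins j x ((z ∷ zs) ∷ τ) (h ∷ hs) =
  (tt ∷ hs) ∷ AllP.map⁺ (All.map (h ∷_) (Fine-joins j x τ hs))

joins-noSuc : ∀ k τ → Fine k τ → All (NoSingleton (suc k)) (joins (suc k) τ)
joins-noSuc k [] [] = []
joins-noSuc k ((z ∷ zs) ∷ τ) (h ∷ hs) = P.cong (false ∨_) (Fine⇒noSuc k τ hs) ∷
  AllP.map⁺ (All.map (P.cong₂ _∨_ (fineBlock⇒notSuc k (z ∷ zs) h)) (joins-noSuc k τ hs))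

extend-NoSingleton : ∀ j y ρ → j < y → NoSingleton j ρ → All (NoSingleton j) (extend y ρ)
extend-NoSingleton j y [] j<y e = P.cong (_∨ false) (≡ᵇ-above j y j<y) ∷ []
extend-NoSingleton j y (b ∷ ρ) j<y e with ∨-false (isSingletonOf j b) _ e
... | eb , eρ = P.cong₂ _∨_ (notJ b) eρ ∷
                AllP.map⁺ (All.map (P.cong₂ _∨_ eb) (extend-NoSingleton j y ρ j<y eρ))
  where
  notJ : ∀ b → isSingletonOf j (y ∷ b) ≡ false
  notJ [] = ≡ᵇ-above j y j<y
  notJ (_ ∷ _) = P.refl

tail : Partition → Partition
tail [] = []
tail (_ ∷ ρ) = ρ

extend-NoSingletonInTail : ∀ j y ρ → j < y → NoSingleton j (tail ρ) →
                           All (λ σ → NoSingleton j (tail σ)) (extend y ρ)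
extend-NoSingletonInTail j y [] j<y e = P.refl ∷ []
extend-NoSingletonInTail j y (b ∷ ρ) j<y e = e ∷ AllP.map⁺ (extend-NoSingleton j y ρ j<y e)

module BinomialSums {c ℓ} (R : CommutativeRing c ℓ) where
  open CommutativeRing R
  open WithRing R
  open import Relation.Binary.Reasoning.Setoid setoid
  open import Algebra.Properties.Ring ring
    using (-‿distribˡ-*; -‿distribʳ-*; -‿+-comm; -1*x≈-x; -‿involutive; xyx⁻¹≈y)

  ≡⇒≈ : ∀ {x y} → x ≡ y → x ≈ y
  ≡⇒≈ P.refl = refl

  x∙yz≈y∙xz : ∀ x y z → x * (y * z) ≈ y * (x * z)
  x∙yz≈y∙xz x y z = trans (sym (*-assoc x y z)) (trans (*-congʳ (*-comm x y)) (*-assoc y x z))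

  +-interchange : ∀ a b c d → (a + b) + (c + d) ≈ (a + c) + (b + d)
  +-interchange a b c d = trans (+-assoc a b (c + d)) (trans (+-congˡ (trans (sym (+-assoc b c d))
    (trans (+-congʳ (+-comm b c)) (+-assoc c b d)))) (sym (+-assoc a c (b + d))))

  +-cancel-− : ∀ a b → a + (b - a) ≈ b
  +-cancel-− a b = trans (sym (+-assoc a b (- a))) (xyx⁻¹≈y a b)

  nat·-cong : ∀ n {x y} → x ≈ y → nat· n x ≈ nat· n y
  nat·-cong zero e = refl
  nat·-cong (suc n) e = +-cong e (nat·-cong n e)

  nat·-+ : ∀ a b x → nat· (a +ℕ b) x ≈ nat· a x + nat· b x
  nat·-+ zero b x = sym (+-identityˡ _)
  nat·-+ (suc a) b x = trans (+-congˡ (nat·-+ a b x)) (sym (+-assoc _ _ _))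

  nat·-*ʳ : ∀ n x y → nat· n x * y ≈ nat· n (x * y)
  nat·-*ʳ zero x y = zeroˡ y
  nat·-*ʳ (suc n) x y = trans (distribʳ y x _) (+-congˡ (nat·-*ʳ n x y))

  nat·-*ˡ : ∀ n x y → x * nat· n y ≈ nat· n (x * y)
  nat·-*ˡ n x y = trans (*-comm x _) (trans (nat·-*ʳ n y x) (nat·-cong n (*-comm y x)))

  sumBelow : ℕ → (ℕ → Carrier) → Carrier
  sumBelow zero f = 0#
  sumBelow (suc n) f = f 0 + sumBelow n (λ k → f (suc k))

  sumR-applyUpTo : ∀ n (g : ℕ → Carrier) (h : ℕ → ℕ) →
                   sumR (map g (applyUpTo h n)) ≡ sumBelow n (λ k → g (h k))
  sumR-applyUpTo zero g h = P.refl
  sumR-applyUpTo (suc n) g h = P.cong (g (h 0) +_) (sumR-applyUpTo n g (λ k → h (suc k)))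

  sumTo≡sumBelow : ∀ n f → sumTo n f ≡ sumBelow (suc n) f
  sumTo≡sumBelow n f = sumR-applyUpTo (suc n) f (λ k → k)

  sumBelow-snoc : ∀ n f → sumBelow (suc n) f ≈ sumBelow n f + f n
  sumBelow-snoc zero f = trans (+-identityʳ _) (sym (+-identityˡ _))
  sumBelow-snoc (suc n) f = trans (+-congˡ (sumBelow-snoc n (λ k → f (suc k)))) (sym (+-assoc _ _ _))

  sumBelow-cong : ∀ n {f g : ℕ → Carrier} → (∀ k → k < n → f k ≈ g k) → sumBelow n f ≈ sumBelow n g
  sumBelow-cong zero e = refl
  sumBelow-cong (suc n) e = +-cong (e 0 (s≤s z≤n)) (sumBelow-cong n (λ k k<n → e (suc k) (s≤s k<n)))

  sumBelow-+ : ∀ n (f g : ℕ → Carrier) → sumBelow n (λ k → f k + g k) ≈ sumBelow n f + sumBelow n g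
  sumBelow-+ zero f g = sym (+-identityˡ 0#)
  sumBelow-+ (suc n) f g = trans (+-congˡ (sumBelow-+ n _ _)) (+-interchange _ _ _ _)

  sumBelow-*ʳ : ∀ n (f : ℕ → Carrier) a → sumBelow n (λ k → f k * a) ≈ sumBelow n f * a
  sumBelow-*ʳ zero f a = sym (zeroˡ a)
  sumBelow-*ʳ (suc n) f a = trans (+-congˡ (sumBelow-*ʳ n _ a)) (sym (distribʳ a _ _))

  sumTo-cong : ∀ n {f g : ℕ → Carrier} → (∀ k → k ≤ n → f k ≈ g k) → sumTo n f ≈ sumTo n g
  sumTo-cong n {f} {g} e = begin
    sumTo n f              ≡⟨ sumTo≡sumBelow n f ⟩
    sumBelow (suc n) f     ≈⟨ sumBelow-cong (suc n) (λ k k<1+n → e k (ℕP.≤-pred k<1+n)) ⟩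
    sumBelow (suc n) g     ≡⟨ P.sym (sumTo≡sumBelow n g) ⟩
    sumTo n g              ∎

  sumTo-*ʳ : ∀ n (f : ℕ → Carrier) a → sumTo n (λ k → f k * a) ≈ sumTo n f * a
  sumTo-*ʳ n f a = begin
    sumTo n (λ k → f k * a)           ≡⟨ sumTo≡sumBelow n _ ⟩
    sumBelow (suc n) (λ k → f k * a)  ≈⟨ sumBelow-*ʳ (suc n) f a ⟩
    sumBelow (suc n) f * a            ≡⟨ P.cong (_* a) (P.sym (sumTo≡sumBelow n f)) ⟩
    sumTo n f * a                     ∎

  -- pathSum n f sums f k l over all lattice paths of length n, k being the
  -- number of up-steps and l the number of right-steps.
  pathSum : ℕ → (ℕ → ℕ → Carrier) → Carrier
  pathSum zero f = f 0 0
  pathSum (suc n) f = pathSum n (λ k l → f k (suc l)) + pathSum n (λ k l → f (suc k) l)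

  pathSum-cong : ∀ n {f g : ℕ → ℕ → Carrier} → (∀ k l → f k l ≈ g k l) → pathSum n f ≈ pathSum n g
  pathSum-cong zero e = e 0 0
  pathSum-cong (suc n) e = +-cong (pathSum-cong n (λ k l → e k (suc l))) (pathSum-cong n (λ k l → e (suc k) l))

  pathSum-+ : ∀ n (f g : ℕ → ℕ → Carrier) → pathSum n (λ k l → f k l + g k l) ≈ pathSum n f + pathSum n g
  pathSum-+ zero f g = refl
  pathSum-+ (suc n) f g = trans (+-cong (pathSum-+ n _ _) (pathSum-+ n _ _)) (+-interchange _ _ _ _)

  pathSum-* : ∀ n a (f : ℕ → ℕ → Carrier) → pathSum n (λ k l → a * f k l) ≈ a * pathSum n f
  pathSum-* zero a f = refl
  pathSum-* (suc n) a f = trans (+-cong (pathSum-* n a _) (pathSum-* n a _)) (sym (distribˡ a _ _))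

  pathSum-neg : ∀ n (f : ℕ → ℕ → Carrier) → pathSum n (λ k l → - f k l) ≈ - pathSum n f
  pathSum-neg zero f = refl
  pathSum-neg (suc n) f = trans (+-cong (pathSum-neg n _) (pathSum-neg n _)) (-‿+-comm _ _)

  pathSum≈binomial : ∀ n (f : ℕ → ℕ → Carrier) →
                     pathSum n f ≈ sumBelow (suc n) (λ k → nat· (n C k) (f k (n ∸ k)))
  pathSum≈binomial zero f = sym (trans (+-identityʳ _) (+-identityʳ _))
  pathSum≈binomial (suc n) f = begin
      pathSum n (λ k l → f k (suc l)) + pathSum n (λ k l → f (suc k) l)
        ≈⟨ +-cong (pathSum≈binomial n _) (pathSum≈binomial n _) ⟩
      (first + rightSteps) + upSteps
        ≈⟨ +-congʳ (+-congˡ rightSteps≈) ⟩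
      (first + rightSteps′) + upSteps
        ≈⟨ +-assoc _ _ _ ⟩
      first + (rightSteps′ + upSteps)
        ≈⟨ +-congˡ (trans (+-comm _ _) (sym (sumBelow-+ (suc n) (λ k → nat· (n C k) (g k)) (λ k → nat· (n C suc k) (g k))))) ⟩
      first + sumBelow (suc n) (λ k → nat· (n C k) (g k) + nat· (n C suc k) (g k))
        ≈⟨ +-congˡ (sumBelow-cong (suc n) (λ k _ → pascal k)) ⟩
      first + sumBelow (suc n) (λ k → nat· (suc n C suc k) (g k)) ∎
    where
    first = nat· (n C 0) (f 0 (suc n))
    g : ℕ → Carrier
    g k = f (suc k) (n ∸ k)
    rightSteps = sumBelow n (λ k → nat· (n C suc k) (f (suc k) (suc (n ∸ suc k))))
    rightSteps′ = sumBelow (suc n) (λ k → nat· (n C suc k) (g k))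
    upSteps = sumBelow (suc n) (λ k → nat· (n C k) (g k))
    -- the extra last term of rightSteps′ has coefficient C(n, n+1) = 0
    rightSteps≈ : rightSteps ≈ rightSteps′
    rightSteps≈ = begin
      rightSteps
        ≈⟨ sumBelow-cong n (λ k k<n → ≡⇒≈ (P.cong (λ l → nat· (n C suc k) (f (suc k) l))
                                                  (P.sym (ℕP.+-∸-assoc 1 k<n)))) ⟩
      sumBelow n (λ k → nat· (n C suc k) (g k))
        ≈⟨ sym (+-identityʳ _) ⟩
      sumBelow n (λ k → nat· (n C suc k) (g k)) + nat· 0 (g n)
        ≡⟨ P.cong (λ z → sumBelow n (λ k → nat· (n C suc k) (g k)) + nat· z (g n)) (P.sym (ℕC.k>n⇒nCk≡0 (ℕP.n<1+n n))) ⟩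
      sumBelow n (λ k → nat· (n C suc k) (g k)) + nat· (n C suc n) (g n)
        ≈⟨ sym (sumBelow-snoc n (λ k → nat· (n C suc k) (g k))) ⟩
      rightSteps′ ∎
    pascal : ∀ k → nat· (n C k) (g k) + nat· (n C suc k) (g k) ≈ nat· (suc n C suc k) (g k)
    pascal k = trans (sym (nat·-+ (n C k) (n C suc k) (g k)))
                     (≡⇒≈ (P.cong (λ z → nat· z (g k)) (ℕC.nCk+nC[k+1]≡[n+1]C[k+1] n k)))

  -- An array b with b (r+1) k = b r (k+1) − c · b r k, i.e. b r = (S − c)^r b 0.
  module Difference (c : Carrier) (b : ℕ → ℕ → Carrier)
                    (b-rec : ∀ r k → b (suc r) k ≈ b r (suc k) - c * b r k) where

    -- Σ_k C(n,k) (−1)^{n−k} S^k (S − c)^{n−k} = c^n, as a path sum.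
    alternating : ∀ n m → pathSum n (λ k l → pow (- 1#) l * b l (m +ℕ k)) ≈ pow c n * b 0 m
    alternating zero m = trans (*-identityˡ _) (trans (≡⇒≈ (P.cong (b 0) (ℕP.+-identityʳ m))) (sym (*-identityˡ _)))
    alternating (suc n) m = begin
      pathSum n (λ k l → pow (- 1#) (suc l) * b (suc l) (m +ℕ k)) + pathSum n shifted
        ≈⟨ +-congʳ (pathSum-cong n step) ⟩
      pathSum n (λ k l → c * unshifted k l - shifted k l) + pathSum n shifted
        ≈⟨ +-congʳ (trans (pathSum-+ n _ _) (+-cong (pathSum-* n c unshifted) (pathSum-neg n shifted))) ⟩
      (c * pathSum n unshifted - pathSum n shifted) + pathSum n shifted
        ≈⟨ trans (+-assoc _ _ _) (trans (+-congˡ (-‿inverseˡ _)) (+-identityʳ _)) ⟩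
      c * pathSum n unshifted
        ≈⟨ *-congˡ (alternating n m) ⟩
      c * (pow c n * b 0 m)
        ≈⟨ sym (*-assoc _ _ _) ⟩
      pow c (suc n) * b 0 m ∎
      where
      unshifted shifted : ℕ → ℕ → Carrier
      unshifted k l = pow (- 1#) l * b l (m +ℕ k)
      shifted k l = pow (- 1#) l * b l (m +ℕ suc k)
      step : ∀ k l → pow (- 1#) (suc l) * b (suc l) (m +ℕ k) ≈ c * unshifted k l - shifted k l
      step k l = begin
        (- 1# * p) * b (suc l) (m +ℕ k)
          ≈⟨ *-cong (-1*x≈-x p) (b-rec l (m +ℕ k)) ⟩
        (- p) * (b l (suc (m +ℕ k)) - c * b l (m +ℕ k))
          ≈⟨ trans (*-comm _ _) (trans (distribʳ (- p) _ _) (+-comm _ _)) ⟩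
        (- (c * b l (m +ℕ k))) * (- p) + b l (suc (m +ℕ k)) * (- p)
          ≈⟨ +-cong (trans (sym (-‿distribˡ-* _ (- p))) (trans (-‿cong (sym (-‿distribʳ-* _ p))) (-‿involutive _)))
                    (sym (-‿distribʳ-* _ p)) ⟩
        (c * b l (m +ℕ k)) * p - b l (suc (m +ℕ k)) * p
          ≈⟨ +-cong (trans (*-assoc c _ p) (*-congˡ (*-comm _ p)))
                    (-‿cong (trans (*-comm _ p) (≡⇒≈ (P.cong (λ z → p * b l z) (P.sym (ℕP.+-suc m k)))))) ⟩
        c * unshifted k l - shifted k l ∎
        where p = pow (- 1#) l

    -- Σ_k C(n,k) (S − c)^k c^{n−k} = S^n, as a path sum.
    forward : ∀ n m → pathSum n (λ k l → b k m * pow c l) ≈ b 0 (m +ℕ n)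
    forward zero m = trans (*-identityʳ _) (≡⇒≈ (P.cong (b 0) (P.sym (ℕP.+-identityʳ m))))
    forward (suc n) m = begin
      pathSum n (λ k l → b k m * pow c (suc l)) + pathSum n (λ k l → b (suc k) m * pow c l)
        ≈⟨ +-congˡ (trans (pathSum-cong n step) (trans (pathSum-+ n _ _) (+-congˡ (pathSum-neg n _)))) ⟩
      pathSum n (λ k l → b k m * pow c (suc l)) + (pathSum n (λ k l → b k (suc m) * pow c l)
                                                  - pathSum n (λ k l → b k m * pow c (suc l)))
        ≈⟨ +-cancel-− _ _ ⟩
      pathSum n (λ k l → b k (suc m) * pow c l)
        ≈⟨ forward n (suc m) ⟩
      b 0 (suc m +ℕ n)
        ≡⟨ P.cong (b 0) (P.sym (ℕP.+-suc m n)) ⟩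
      b 0 (m +ℕ suc n) ∎
      where
      step : ∀ k l → b (suc k) m * pow c l ≈ b k (suc m) * pow c l - b k m * pow c (suc l)
      step k l = trans (*-congʳ (b-rec k m)) (trans (distribʳ _ _ _) (+-congˡ (trans (sym (-‿distribˡ-* _ _))
                   (-‿cong (trans (*-congʳ (*-comm c (b k m))) (*-assoc _ _ _))))))

    alternatingBinomial : ∀ n m →
      sumTo n (λ k → pow (- 1#) (n ∸ k) * nat· (n C k) (b (n ∸ k) (m +ℕ k))) ≈ pow c n * b 0 m
    alternatingBinomial n m = begin
      sumTo n (λ k → pow (- 1#) (n ∸ k) * nat· (n C k) (b (n ∸ k) (m +ℕ k)))
        ≈⟨ sumTo-cong n (λ k _ → nat·-*ˡ (n C k) _ _) ⟩
      sumTo n (λ k → nat· (n C k) (pow (- 1#) (n ∸ k) * b (n ∸ k) (m +ℕ k)))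
        ≡⟨ sumTo≡sumBelow n _ ⟩
      sumBelow (suc n) (λ k → nat· (n C k) (pow (- 1#) (n ∸ k) * b (n ∸ k) (m +ℕ k)))
        ≈⟨ sym (pathSum≈binomial n (λ k l → pow (- 1#) l * b l (m +ℕ k))) ⟩
      pathSum n (λ k l → pow (- 1#) l * b l (m +ℕ k))
        ≈⟨ alternating n m ⟩
      pow c n * b 0 m ∎

    forwardBinomial : ∀ n m → sumTo n (λ k → nat· (n C k) (b k m) * pow c (n ∸ k)) ≈ b 0 (m +ℕ n)
    forwardBinomial n m = begin
      sumTo n (λ k → nat· (n C k) (b k m) * pow c (n ∸ k))
        ≈⟨ sumTo-cong n (λ k _ → nat·-*ʳ (n C k) _ _) ⟩
      sumTo n (λ k → nat· (n C k) (b k m * pow c (n ∸ k)))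
        ≡⟨ sumTo≡sumBelow n _ ⟩
      sumBelow (suc n) (λ k → nat· (n C k) (b k m * pow c (n ∸ k)))
        ≈⟨ sym (pathSum≈binomial n (λ k l → b k m * pow c l)) ⟩
      pathSum n (λ k l → b k m * pow c l)
        ≈⟨ forward n m ⟩
      b 0 (m +ℕ n) ∎

module ListSums {c ℓ} (R : CommutativeRing c ℓ) where
  open CommutativeRing R
  open WithRing R
  open import Algebra.Properties.Ring ring using (-0#≈0#; -‿+-comm)
  open BinomialSums R using (≡⇒≈; +-interchange)

  sumL : ∀ {A : Set} → (A → Carrier) → List A → Carrier
  sumL f xs = sumR (map f xs)

  sumL-map : ∀ {A B : Set} (f : B → Carrier) (h : A → B) xs → sumL f (map h xs) ≡ sumL (λ x → f (h x)) xs
  sumL-map f h [] = P.refl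
  sumL-map f h (x ∷ xs) = P.cong (f (h x) +_) (sumL-map f h xs)

  sumL-++ : ∀ {A : Set} (f : A → Carrier) xs ys → sumL f (xs ++ ys) ≈ sumL f xs + sumL f ys
  sumL-++ f [] ys = sym (+-identityˡ _)
  sumL-++ f (x ∷ xs) ys = trans (+-congˡ (sumL-++ f xs ys)) (sym (+-assoc _ _ _))

  sumL-concatMap : ∀ {A B : Set} (f : B → Carrier) (g : A → List B) xs →
                   sumL f (concatMap g xs) ≈ sumL (λ x → sumL f (g x)) xs
  sumL-concatMap f g [] = refl
  sumL-concatMap f g (x ∷ xs) = trans (sumL-++ f (g x) (concatMap g xs)) (+-congˡ (sumL-concatMap f g xs))

  sumL-cong : ∀ {A : Set} {f g : A → Carrier} xs → (∀ x → f x ≈ g x) → sumL f xs ≈ sumL g xs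
  sumL-cong [] e = refl
  sumL-cong (x ∷ xs) e = +-cong (e x) (sumL-cong xs e)

  sumL-congAll : ∀ {A : Set} {f g : A → Carrier} {xs} → All (λ x → f x ≈ g x) xs → sumL f xs ≈ sumL g xs
  sumL-congAll [] = refl
  sumL-congAll (e ∷ es) = +-cong e (sumL-congAll es)

  sumL-+ : ∀ {A : Set} (f g : A → Carrier) xs → sumL (λ x → f x + g x) xs ≈ sumL f xs + sumL g xs
  sumL-+ f g [] = sym (+-identityˡ 0#)
  sumL-+ f g (x ∷ xs) = trans (+-congˡ (sumL-+ f g xs)) (+-interchange (f x) (g x) _ _)

  sumL-* : ∀ {A : Set} (a : Carrier) (f : A → Carrier) xs → sumL (λ x → a * f x) xs ≈ a * sumL f xs
  sumL-* a f [] = sym (zeroʳ a)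
  sumL-* a f (x ∷ xs) = trans (+-congˡ (sumL-* a f xs)) (sym (distribˡ a _ _))

  sumL-neg : ∀ {A : Set} (f : A → Carrier) xs → sumL (λ x → - f x) xs ≈ - sumL f xs
  sumL-neg f [] = sym -0#≈0#
  sumL-neg f (x ∷ xs) = trans (+-congˡ (sumL-neg f xs)) (-‿+-comm _ _)

  sumL-0 : ∀ {A : Set} (xs : List A) → sumL (λ _ → 0#) xs ≈ 0#
  sumL-0 [] = refl
  sumL-0 (x ∷ xs) = trans (+-identityˡ _) (sumL-0 xs)

  prodR-↭ : ∀ {xs ys} → xs ↭ ys → prodR xs ≈ prodR ys
  prodR-↭ {xs} {ys} q = trans (≡⇒≈ (prodR≡foldr xs)) (trans
    (PermₛP.foldr-commMonoid setoid *-isCommutativeMonoid (↭⇒↭ₛ′ isEquivalence q))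
    (≡⇒≈ (P.sym (prodR≡foldr ys))))
    where
    prodR≡foldr : ∀ xs → prodR xs ≡ foldr _*_ 1# xs
    prodR≡foldr [] = P.refl
    prodR≡foldr (x ∷ xs) = P.cong (x *_) (prodR≡foldr xs)

module PartitionSums {c ℓ} (R : CommutativeRing c ℓ) (t : ℕ → CommutativeRing.Carrier R) where
  open CommutativeRing R
  open WithRing R
  open import Relation.Binary.Reasoning.Setoid setoid
  open import Algebra.Properties.Ring ring using (-0#≈0#; x[y-z]≈xy-xz)
  open BinomialSums R using (≡⇒≈)
  open ListSums R

  x-0 : ∀ x → x - 0# ≈ x
  x-0 x = trans (+-congˡ -0#≈0#) (+-identityʳ x)

  w : Partition → Carrier
  w = weight t

  weight-↭ : ∀ {σ σ'} → σ ↭ σ' → w σ ≈ w σ'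
  weight-↭ q = prodR-↭ (PermP.map⁺ (λ b → t (length b)) q)

  shape : Partition → List ℕ
  shape = map length

  weight-shape : ∀ τ τ' → shape τ ≡ shape τ' → w τ ≡ w τ'
  weight-shape [] [] e = P.refl
  weight-shape (b ∷ τ) (b' ∷ τ') e =
    P.cong₂ (λ l z → t l * z) (ListP.∷-injectiveˡ e) (weight-shape τ τ' (ListP.∷-injectiveʳ e))

  guard : Bool → Carrier → Carrier
  guard p x = if p then x else 0#

  guard-cong : ∀ {p p'} {x y} → p ≡ p' → x ≈ y → guard p x ≈ guard p' y
  guard-cong {true} P.refl e = e
  guard-cong {false} P.refl e = refl

  guard-* : ∀ p a x → guard p (a * x) ≈ a * guard p x
  guard-* true a x = refl
  guard-* false a x = sym (zeroʳ a)

  sum-filter : ∀ (p : Partition → Bool) L →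
               sumR (map w (filter (λ π → p π ≟ᵇ true) L)) ≈ sumL (λ π → guard (p π) (w π)) L
  sum-filter p [] = refl
  sum-filter p (π ∷ L) with p π
  ... | true = +-congˡ (sum-filter p L)
  ... | false = trans (sum-filter p L) (sym (+-identityˡ _))

  -- Every partition of [N+r]
  -- arises from exactly one partition of [N] in this way (partitions-Ext).
  Ext : Partition → ℕ → ℕ → (Partition → Carrier) → Carrier
  Ext τ x zero g = g τ
  Ext τ x (suc r) g = sumL (λ σ → Ext σ (suc x) r g) (extend x τ)

  Ext-cong : ∀ r x τ {g h : Partition → Carrier} → (∀ ρ → g ρ ≈ h ρ) → Ext τ x r g ≈ Ext τ x r h
  Ext-cong zero x τ e = e τ
  Ext-cong (suc r) x τ e = sumL-cong (extend x τ) (λ σ → Ext-cong r (suc x) σ e)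

  Ext-+ : ∀ r x τ (g h : Partition → Carrier) → Ext τ x r (λ ρ → g ρ + h ρ) ≈ Ext τ x r g + Ext τ x r h
  Ext-+ zero x τ g h = refl
  Ext-+ (suc r) x τ g h = trans (sumL-cong (extend x τ) (λ σ → Ext-+ r (suc x) σ g h)) (sumL-+ _ _ (extend x τ))

  Ext-* : ∀ r x τ a (g : Partition → Carrier) → Ext τ x r (λ ρ → a * g ρ) ≈ a * Ext τ x r g
  Ext-* zero x τ a g = refl
  Ext-* (suc r) x τ a g = trans (sumL-cong (extend x τ) (λ σ → Ext-* r (suc x) σ a g)) (sumL-* a _ (extend x τ))

  Ext-neg : ∀ r x τ (g : Partition → Carrier) → Ext τ x r (λ ρ → - g ρ) ≈ - Ext τ x r g
  Ext-neg zero x τ g = refl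
  Ext-neg (suc r) x τ g = trans (sumL-cong (extend x τ) (λ σ → Ext-neg r (suc x) σ g)) (sumL-neg _ (extend x τ))

  Ext-− : ∀ r x τ (g h : Partition → Carrier) → Ext τ x r (λ ρ → g ρ - h ρ) ≈ Ext τ x r g - Ext τ x r h
  Ext-− r x τ g h = trans (Ext-+ r x τ g (λ ρ → - h ρ)) (+-congˡ (Ext-neg r x τ h))

  Ext-0 : ∀ r x τ → Ext τ x r (λ _ → 0#) ≈ 0#
  Ext-0 zero x τ = refl
  Ext-0 (suc r) x τ = trans (sumL-cong (extend x τ) (λ σ → Ext-0 r (suc x) σ)) (sumL-0 (extend x τ))

  Ext-invariant : ∀ (j : ℕ) (Inv : Partition → Set) → (∀ y ρ → j < y → Inv ρ → All Inv (extend y ρ)) →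
                  ∀ r x τ {g h : Partition → Carrier} → j < x → Inv τ → (∀ ρ → Inv ρ → g ρ ≈ h ρ) →
                  Ext τ x r g ≈ Ext τ x r h
  Ext-invariant j Inv pres zero x τ j<x i e = e τ i
  Ext-invariant j Inv pres (suc r) x τ j<x i e = sumL-congAll
    (All.map (λ {σ} iσ → Ext-invariant j Inv pres r (suc x) σ (ℕP.m<n⇒m<1+n j<x) iσ e) (pres x τ j<x i))

  Resp↭ : (Partition → Carrier) → Set _
  Resp↭ F = ∀ {σ σ'} → σ ↭ σ' → F σ ≈ F σ'

  extend-↭ : ∀ x (F : Partition → Carrier) → Resp↭ F → ∀ {τ τ'} → τ ↭ τ' →
             sumL F (extend x τ) ≈ sumL F (extend x τ')
  extend-↭ x F F↭ Perm.refl = refl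
  extend-↭ x F F↭ (Perm.prep {xs = τ} {ys = τ'} b q) =
    +-cong (F↭ (Perm.prep _ q)) (begin
      sumL F (map (b ∷_) (extend x τ))      ≡⟨ sumL-map F (b ∷_) (extend x τ) ⟩
      sumL (λ σ → F (b ∷ σ)) (extend x τ)   ≈⟨ extend-↭ x (λ σ → F (b ∷ σ)) (λ q' → F↭ (Perm.prep b q')) q ⟩
      sumL (λ σ → F (b ∷ σ)) (extend x τ')  ≡⟨ P.sym (sumL-map F (b ∷_) (extend x τ')) ⟩
      sumL F (map (b ∷_) (extend x τ'))     ∎)
  extend-↭ x F F↭ (Perm.swap {xs = τ} {ys = τ'} a b q) =
    trans (sym (+-assoc _ _ _)) (trans (+-congʳ (+-comm _ _)) (trans (+-assoc _ _ _)
      (+-cong (F↭ (Perm.swap a (x ∷ b) q)) (+-cong (F↭ (Perm.swap (x ∷ a) b q)) bothKept))))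
    where
    bothKept : sumL F (map (a ∷_) (map (b ∷_) (extend x τ))) ≈ sumL F (map (b ∷_) (map (a ∷_) (extend x τ')))
    bothKept = begin
      sumL F (map (a ∷_) (map (b ∷_) (extend x τ)))
        ≡⟨ P.trans (sumL-map F (a ∷_) (map (b ∷_) (extend x τ))) (sumL-map (λ σ → F (a ∷ σ)) (b ∷_) (extend x τ)) ⟩
      sumL (λ σ → F (a ∷ b ∷ σ)) (extend x τ)
        ≈⟨ extend-↭ x (λ σ → F (a ∷ b ∷ σ)) (λ q' → F↭ (Perm.prep a (Perm.prep b q'))) q ⟩
      sumL (λ σ → F (a ∷ b ∷ σ)) (extend x τ')
        ≈⟨ sumL-cong (extend x τ') (λ σ → F↭ (Perm.swap a b Perm.refl)) ⟩
      sumL (λ σ → F (b ∷ a ∷ σ)) (extend x τ')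
        ≡⟨ P.sym (P.trans (sumL-map F (b ∷_) (map (a ∷_) (extend x τ'))) (sumL-map (λ σ → F (b ∷ σ)) (a ∷_) (extend x τ'))) ⟩
      sumL F (map (b ∷_) (map (a ∷_) (extend x τ'))) ∎
  extend-↭ x F F↭ (Perm.trans q q') = trans (extend-↭ x F F↭ q) (extend-↭ x F F↭ q')

  Ext-↭ : ∀ r x (g : Partition → Carrier) → Resp↭ g → ∀ {τ τ'} → τ ↭ τ' → Ext τ x r g ≈ Ext τ' x r g
  Ext-↭ zero x g g↭ q = g↭ q
  Ext-↭ (suc r) x g g↭ q = extend-↭ x (λ σ → Ext σ (suc x) r g) (λ q' → Ext-↭ r (suc x) g g↭ q') q

  Ext-headTooBig : ∀ r x (n : ℕ) (g : Partition → Carrier) → (∀ b ρ → n < length b → g (b ∷ ρ) ≈ 0#) →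
                   ∀ b τ → n < length b → Ext (b ∷ τ) x r g ≈ 0#
  Ext-headTooBig zero x n g g0 b τ n<b = g0 b τ n<b
  Ext-headTooBig (suc r) x n g g0 b τ n<b = trans
    (+-cong (Ext-headTooBig r (suc x) n g g0 (x ∷ b) τ (ℕP.m<n⇒m<1+n n<b))
            (trans (≡⇒≈ (sumL-map (λ σ → Ext σ (suc x) r g) (b ∷_) (extend x τ)))
                   (trans (sumL-cong (extend x τ) (λ σ → Ext-headTooBig r (suc x) n g g0 b σ n<b))
                          (sumL-0 (extend x τ)))))
    (+-identityˡ 0#)

  Ext-fixHead : ∀ r x (g : Partition → Carrier) c → (∀ b ρ → length c < length b → g (b ∷ ρ) ≈ 0#) →
                ∀ τ → Ext (c ∷ τ) x r g ≈ Ext τ x r (λ ρ → g (c ∷ ρ))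
  Ext-fixHead zero x g c g0 τ = refl
  Ext-fixHead (suc r) x g c g0 τ = trans
    (+-cong (Ext-headTooBig r (suc x) (length c) g g0 (x ∷ c) τ ℕP.≤-refl)
            (trans (≡⇒≈ (sumL-map (λ σ → Ext σ (suc x) r g) (c ∷_) (extend x τ)))
                   (sumL-cong (extend x τ) (λ σ → Ext-fixHead r (suc x) g c g0 σ))))
    (+-identityˡ _)

  Ext-relabelHead : ∀ r x (g : Partition → Carrier) →
                    (∀ b b' ρ → length b ≡ length b' → g (b ∷ ρ) ≈ g (b' ∷ ρ)) →
                    ∀ c c' τ → length c ≡ length c' → Ext (c ∷ τ) x r g ≈ Ext (c' ∷ τ) x r g
  Ext-relabelHead zero x g gl c c' τ e = gl c c' τ e
  Ext-relabelHead (suc r) x g gl c c' τ e = +-cong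
    (Ext-relabelHead r (suc x) g gl (x ∷ c) (x ∷ c') τ (P.cong suc e))
    (trans (≡⇒≈ (sumL-map (λ σ → Ext σ (suc x) r g) (c ∷_) (extend x τ)))
      (trans (sumL-cong (extend x τ) (λ σ → Ext-relabelHead r (suc x) g gl c c' σ e))
        (≡⇒≈ (P.sym (sumL-map (λ σ → Ext σ (suc x) r g) (c' ∷_) (extend x τ))))))

  Ext-last : ∀ r x τ (g : Partition → Carrier) → Ext τ x (suc r) g ≈ Ext τ x r (λ ρ → sumL g (extend (r +ℕ x) ρ))
  Ext-last zero x τ g = refl
  Ext-last (suc r) x τ g = sumL-cong (extend x τ) (λ σ → trans (Ext-last r (suc x) σ g)
    (Ext-cong r (suc x) σ (λ ρ → ≡⇒≈ (P.cong (λ z → sumL g (extend z ρ)) (ℕP.+-suc r x)))))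

  partitions-Ext : ∀ r N (g : Partition → Carrier) →
                   sumL g (partitions (r +ℕ N)) ≈ sumL (λ π → Ext π (suc N) r g) (partitions N)
  partitions-Ext zero N g = refl
  partitions-Ext (suc r) N g = begin
    sumL g (concatMap (extend (suc (r +ℕ N))) (partitions (r +ℕ N)))
      ≈⟨ sumL-concatMap g (extend (suc (r +ℕ N))) (partitions (r +ℕ N)) ⟩
    sumL (λ ρ → sumL g (extend (suc (r +ℕ N)) ρ)) (partitions (r +ℕ N))
      ≈⟨ partitions-Ext r N _ ⟩
    sumL (λ π → Ext π (suc N) r (λ ρ → sumL g (extend (suc (r +ℕ N)) ρ))) (partitions N)
      ≈⟨ sumL-cong (partitions N) (λ π → sym (trans (Ext-last r (suc N) π g)
           (Ext-cong r (suc N) π (λ ρ → ≡⇒≈ (P.cong (λ z → sumL g (extend z ρ)) (ℕP.+-suc r N)))))) ⟩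
    sumL (λ π → Ext π (suc N) (suc r) g) (partitions N) ∎

  fineWeight : ℕ → Partition → Carrier
  fineWeight j ρ = guard (all (singletonAtMost j) ρ) (w ρ)

  fineWeight-↭ : ∀ j → Resp↭ (fineWeight j)
  fineWeight-↭ j q = guard-cong (and-↭ (singletonAtMost j) q) (weight-↭ q)

  largestWeight : ℕ → Partition → Carrier
  largestWeight j ρ = guard (largestSingletonIs j ρ) (w ρ)

  largestWeight-↭ : ∀ j → Resp↭ (largestWeight j)
  largestWeight-↭ j q =
    guard-cong (P.cong₂ _∧_ (or-↭ (isSingletonOf j) q) (and-↭ (singletonAtMost j) q)) (weight-↭ q)

  tailFineWeight headBadWeight : ℕ → Partition → Carrier
  tailFineWeight j [] = fineWeight j []
  tailFineWeight j (b ∷ ρ) = guard (all (singletonAtMost j) ρ) (w (b ∷ ρ))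
  headBadWeight j [] = 0#
  headBadWeight j (b ∷ ρ) = if singletonAtMost j b then 0# else guard (all (singletonAtMost j) ρ) (w (b ∷ ρ))

  fineWeight-split : ∀ j ρ → fineWeight j ρ ≈ tailFineWeight j ρ - headBadWeight j ρ
  fineWeight-split j [] = sym (x-0 _)
  fineWeight-split j (b ∷ ρ) = split (singletonAtMost j b) (all (singletonAtMost j) ρ) (w (b ∷ ρ))
    where
    split : ∀ p q W → guard (p ∧ q) W ≈ guard q W - (if p then 0# else guard q W)
    split true true W = sym (x-0 W)
    split true false W = sym (x-0 0#)
    split false true W = sym (-‿inverseʳ W)
    split false false W = sym (x-0 0#)

  headBadWeight-big : ∀ j b ρ → 1 < length b → headBadWeight j (b ∷ ρ) ≈ 0#
  headBadWeight-big j (_ ∷ _ ∷ _) ρ _ = refl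
  headBadWeight-big j (_ ∷ []) ρ (s≤s ())

  -- Inclusion–exclusion for a singleton {y}, y > j, that is not allowed to
  -- survive: the extensions in which it gets joined by a new element are all
  -- extensions of {0} ∷ τ (where the condition is void) minus those in which
  -- it stays a singleton.
  removeBadSingleton : ∀ j y τ x r → j < y →
    Ext ([ y ] ∷ τ) x r (fineWeight j) ≈ Ext ([ 0 ] ∷ τ) x r (fineWeight j) - t 1 * Ext τ x r (fineWeight j)
  removeBadSingleton j y τ x r j<y = begin
      Ext ([ y ] ∷ τ) x r (fineWeight j)
        ≈⟨ splitExt y ⟩
      Ext ([ y ] ∷ τ) x r (tailFineWeight j) - Ext ([ y ] ∷ τ) x r (headBadWeight j)
        ≈⟨ +-cong (Ext-relabelHead r x (tailFineWeight j) tail-relabel [ y ] [ 0 ] τ P.refl) (-‿cong yStays) ⟩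
      Ext ([ 0 ] ∷ τ) x r (tailFineWeight j) - t 1 * Ext τ x r (fineWeight j)
        ≈⟨ +-congʳ (sym zeroExt) ⟩
      Ext ([ 0 ] ∷ τ) x r (fineWeight j) - t 1 * Ext τ x r (fineWeight j) ∎
    where
    splitExt : ∀ z → Ext ([ z ] ∷ τ) x r (fineWeight j) ≈
                      Ext ([ z ] ∷ τ) x r (tailFineWeight j) - Ext ([ z ] ∷ τ) x r (headBadWeight j)
    splitExt z = trans (Ext-cong r x _ (fineWeight-split j)) (Ext-− r x _ (tailFineWeight j) (headBadWeight j))
    tail-relabel : ∀ b b' ρ → length b ≡ length b' → tailFineWeight j (b ∷ ρ) ≈ tailFineWeight j (b' ∷ ρ)
    tail-relabel b b' ρ e = ≡⇒≈ (P.cong (λ l → guard (all (singletonAtMost j) ρ) (t l * w ρ)) e)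
    headBad : ∀ z ρ → headBadWeight j ([ z ] ∷ ρ) ≈ (if z ≤ᵇ j then 0# else t 1 * fineWeight j ρ)
    headBad z ρ with z ≤ᵇ j
    ... | true = refl
    ... | false = guard-* _ (t 1) (w ρ)
    yStays : Ext ([ y ] ∷ τ) x r (headBadWeight j) ≈ t 1 * Ext τ x r (fineWeight j)
    yStays = begin
      Ext ([ y ] ∷ τ) x r (headBadWeight j)
        ≈⟨ Ext-fixHead r x (headBadWeight j) [ y ] (headBadWeight-big j) τ ⟩
      Ext τ x r (λ ρ → headBadWeight j ([ y ] ∷ ρ))
        ≈⟨ Ext-cong r x τ (λ ρ → trans (headBad y ρ)
             (≡⇒≈ (P.cong (λ p → if p then 0# else t 1 * fineWeight j ρ) (≤ᵇ-above j y j<y)))) ⟩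
      Ext τ x r (λ ρ → t 1 * fineWeight j ρ)
        ≈⟨ Ext-* r x τ (t 1) (fineWeight j) ⟩
      t 1 * Ext τ x r (fineWeight j) ∎
    zeroExt : Ext ([ 0 ] ∷ τ) x r (fineWeight j) ≈ Ext ([ 0 ] ∷ τ) x r (tailFineWeight j)
    zeroExt = trans (splitExt 0) (trans (+-congˡ (-‿cong (trans
      (Ext-fixHead r x (headBadWeight j) [ 0 ] (headBadWeight-big j) τ)
      (trans (Ext-cong r x τ (headBad 0)) (Ext-0 r x τ))))) (x-0 _))

  -- W τ x r: inclusion–exclusion sum over the extensions of τ by x, ..., x+r−1
  -- in which no new element ends up as a singleton; at each step the
  -- extensions where the inserted element stays alone are subtracted.
  W : Partition → ℕ → ℕ → Carrier
  W τ x zero = w τ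
  W τ x (suc r) = sumL (λ σ → W σ (suc x) r) (extend x τ) - t 1 * W τ (suc x) r

  extend-shape : ∀ x x' (F F' : Partition → Carrier) → (∀ σ σ' → shape σ ≡ shape σ' → F σ ≈ F' σ') →
                 ∀ τ τ' → shape τ ≡ shape τ' → sumL F (extend x τ) ≈ sumL F' (extend x' τ')
  extend-shape x x' F F' h [] [] e = +-congʳ (h _ _ P.refl)
  extend-shape x x' F F' h (b ∷ τ) (b' ∷ τ') e = +-cong
    (h _ _ (P.cong₂ _∷_ (P.cong suc (ListP.∷-injectiveˡ e)) (ListP.∷-injectiveʳ e)))
    (trans (≡⇒≈ (sumL-map F (b ∷_) (extend x τ)))
      (trans (extend-shape x x' (λ σ → F (b ∷ σ)) (λ σ → F' (b' ∷ σ))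
                (λ σ σ' e' → h _ _ (P.cong₂ _∷_ (ListP.∷-injectiveˡ e) e')) τ τ' (ListP.∷-injectiveʳ e))
        (≡⇒≈ (P.sym (sumL-map F' (b' ∷_) (extend x' τ'))))))

  W-shape : ∀ r τ τ' x x' → shape τ ≡ shape τ' → W τ x r ≈ W τ' x' r
  W-shape zero τ τ' x x' e = ≡⇒≈ (weight-shape τ τ' e)
  W-shape (suc r) τ τ' x x' e =
    +-cong (extend-shape x x' _ _ (λ σ σ' e' → W-shape r σ σ' (suc x) (suc x') e') τ τ' e)
           (-‿cong (*-congˡ (W-shape r τ τ' (suc x) (suc x') e)))

  -- If τ is fine below j < x, summing fineWeight j over the extensions of τ is
  -- the inclusion–exclusion sum W.  The new singleton {x} is moved to the
  -- front and removed by removeBadSingleton.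
  Ext≈W : ∀ r j x τ → j < x → Fine j τ → Ext τ x r (fineWeight j) ≈ W τ x r
  Ext≈W zero j x τ j<x f = ≡⇒≈ (P.cong (λ p → guard p (w τ)) (Fine⇒allAtMost j τ f))
  Ext≈W (suc r) j x τ j<x f = begin
    sumL (λ σ → G σ) (extend x τ)
      ≡⟨ P.cong (sumL G) (extend-split x τ) ⟩
    sumL G (joins x τ ++ [ τ ++ [ [ x ] ] ])
      ≈⟨ trans (sumL-++ G (joins x τ) _) (+-congˡ (+-identityʳ _)) ⟩
    sumL G (joins x τ) + G (τ ++ [ [ x ] ])
      ≈⟨ +-cong (sumL-congAll (All.map (λ {σ} → Ext≈W r j (suc x) σ j<1+x) (Fine-joins j x τ f))) newSingleton ⟩
    sumL V (joins x τ) + (V (τ ++ [ [ x ] ]) - t 1 * W τ (suc x) r)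
      ≈⟨ sym (+-assoc _ _ _) ⟩
    (sumL V (joins x τ) + V (τ ++ [ [ x ] ])) - t 1 * W τ (suc x) r
      ≈⟨ +-congʳ (sym (trans (≡⇒≈ (P.cong (sumL V) (extend-split x τ)))
                             (trans (sumL-++ V (joins x τ) _) (+-congˡ (+-identityʳ _))))) ⟩
    W τ x (suc r) ∎
    where
    G V : Partition → Carrier
    G σ = Ext σ (suc x) r (fineWeight j)
    V σ = W σ (suc x) r
    j<1+x : j < suc x
    j<1+x = ℕP.m<n⇒m<1+n j<x
    toFront : ∀ z → G (τ ++ [ [ z ] ]) ≈ G ([ z ] ∷ τ)
    toFront z = Ext-↭ r (suc x) (fineWeight j) (fineWeight-↭ j) (Perm.↭-sym (PermP.∷↭∷ʳ [ z ] τ))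
    newSingleton : G (τ ++ [ [ x ] ]) ≈ V (τ ++ [ [ x ] ]) - t 1 * W τ (suc x) r
    newSingleton = begin
      G (τ ++ [ [ x ] ])
        ≈⟨ toFront x ⟩
      G ([ x ] ∷ τ)
        ≈⟨ removeBadSingleton j x τ (suc x) r j<x ⟩
      G ([ 0 ] ∷ τ) - t 1 * G τ
        ≈⟨ +-cong (sym (toFront 0)) (-‿cong (*-congˡ (Ext≈W r j (suc x) τ j<1+x f))) ⟩
      G (τ ++ [ [ 0 ] ]) - t 1 * W τ (suc x) r
        ≈⟨ +-congʳ (trans (Ext≈W r j (suc x) (τ ++ [ [ 0 ] ]) j<1+x (AllP.++⁺ f (tt ∷ [])))
             (W-shape r _ _ (suc x) (suc x) (P.trans (ListP.map-++ length τ _) (P.sym (ListP.map-++ length τ _))))) ⟩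
      V (τ ++ [ [ x ] ]) - t 1 * W τ (suc x) r ∎

  -- Q r N: the inclusion–exclusion sum over partitions of [N+r] with no
  -- singleton above N; its recursion is the difference recurrence.
  Q : ℕ → ℕ → Carrier
  Q r N = sumL (λ π → W π (suc N) r) (partitions N)

  Q-rec : ∀ r N → Q (suc r) N ≈ Q r (suc N) - t 1 * Q r N
  Q-rec r N = begin
    sumL (λ π → sumL (λ σ → W σ (suc (suc N)) r) (extend (suc N) π) - t 1 * W π (suc (suc N)) r) (partitions N)
      ≈⟨ sumL-+ _ _ (partitions N) ⟩
    sumL (λ π → sumL (λ σ → W σ (suc (suc N)) r) (extend (suc N) π)) (partitions N)
      + sumL (λ π → - (t 1 * W π (suc (suc N)) r)) (partitions N)
      ≈⟨ +-cong (sym (sumL-concatMap _ (extend (suc N)) (partitions N)))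
                (trans (sumL-neg _ (partitions N)) (-‿cong (trans (sumL-* (t 1) _ (partitions N))
                   (*-congˡ (sumL-cong (partitions N) (λ π → W-shape r π π _ _ P.refl)))))) ⟩
    Q r (suc N) - t 1 * Q r N ∎

  headSingletonWeight : ℕ → Partition → Carrier
  headSingletonWeight j [] = 0#
  headSingletonWeight j (b ∷ ρ) = if isSingletonOf j b then guard (all (singletonAtMost j) ρ) (w (b ∷ ρ)) else 0#

  largest≈headSingleton : ∀ j ρ → NoSingleton j (tail ρ) → largestWeight j ρ ≈ headSingletonWeight j ρ
  largest≈headSingleton j [] _ = refl
  largest≈headSingleton j (b ∷ ρ) noJ =
    onlyHead (isSingletonOf j b) _ (singletonAtMost j b) _ (w (b ∷ ρ)) noJ (singletonOf⇒atMost j b)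
    where
    onlyHead : ∀ a o s q W → o ≡ false → (a ≡ true → s ≡ true) →
               guard ((a ∨ o) ∧ (s ∧ q)) W ≈ (if a then guard q W else 0#)
    onlyHead true .false s q W P.refl h rewrite h P.refl = refl
    onlyHead false .false s q W P.refl h = refl

  headSingletonWeight-big : ∀ j b ρ → 1 < length b → headSingletonWeight j (b ∷ ρ) ≈ 0#
  headSingletonWeight-big j (_ ∷ _ ∷ _) ρ _ = refl
  headSingletonWeight-big j (_ ∷ []) ρ (s≤s ())

  -- If k+1 joins a block, {k+1} never appears; otherwise {k+1} must stay
  -- alone, contributing t₁, and the other new elements must not be singletons.
  Ext-largest : ∀ k r π → Fine k π → Ext π (suc k) (suc r) (largestWeight (suc k)) ≈ t 1 * W π (suc k) r
  Ext-largest k r π f = begin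
      sumL L (extend j π)
        ≡⟨ P.cong (sumL L) (extend-split j π) ⟩
      sumL L (joins j π ++ [ π ++ [ [ j ] ] ])
        ≈⟨ trans (sumL-++ L (joins j π) _) (+-cong joinsVanish (+-identityʳ _)) ⟩
      0# + L (π ++ [ [ j ] ])
        ≈⟨ +-identityˡ _ ⟩
      L (π ++ [ [ j ] ])
        ≈⟨ Ext-↭ r (suc j) (largestWeight j) (largestWeight-↭ j) (Perm.↭-sym (PermP.∷↭∷ʳ [ j ] π)) ⟩
      L ([ j ] ∷ π)
        ≈⟨ Ext-invariant j (λ ρ → NoSingleton j (tail ρ)) (extend-NoSingletonInTail j) r (suc j) ([ j ] ∷ π)
             j<1+j (Fine⇒noSuc k π f) (largest≈headSingleton j) ⟩
      Ext ([ j ] ∷ π) (suc j) r (headSingletonWeight j)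
        ≈⟨ Ext-fixHead r (suc j) (headSingletonWeight j) [ j ] (headSingletonWeight-big j) π ⟩
      Ext π (suc j) r (λ ρ → headSingletonWeight j ([ j ] ∷ ρ))
        ≈⟨ Ext-cong r (suc j) π (λ ρ → trans (≡⇒≈ (P.cong (λ p → if p then fineHead ρ else 0#) (dec-true (j ≟ j) P.refl)))
                                             (guard-* _ (t 1) (w ρ))) ⟩
      Ext π (suc j) r (λ ρ → t 1 * fineWeight j ρ)
        ≈⟨ Ext-* r (suc j) π (t 1) (fineWeight j) ⟩
      t 1 * Ext π (suc j) r (fineWeight j)
        ≈⟨ *-congˡ (trans (Ext≈W r j (suc j) π j<1+j (All.map (λ {b} → fineBlock-suc k b) f))
                          (W-shape r π π _ _ P.refl)) ⟩
      t 1 * W π (suc k) r ∎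
    where
    j = suc k
    j<1+j : j < suc j
    j<1+j = ℕP.≤-refl
    L : Partition → Carrier
    L σ = Ext σ (suc j) r (largestWeight j)
    fineHead : Partition → Carrier
    fineHead ρ = guard (all (singletonAtMost j) ρ) (t 1 * w ρ)
    joinsVanish : sumL L (joins j π) ≈ 0#
    joinsVanish = trans (sumL-congAll (All.map (λ {σ} noJ → trans
      (Ext-invariant j (NoSingleton j) (extend-NoSingleton j) r (suc j) σ j<1+j noJ
         (λ ρ noJρ → ≡⇒≈ (P.cong (λ p → guard (p ∧ all (singletonAtMost j) ρ) (w ρ)) noJρ)))
      (Ext-0 r (suc j) σ)) (joins-noSuc k π f))) (sumL-0 (joins j π))

  B : ℕ → ℕ → Carrier
  B r k = t 1 * Q r k

  A≈B : ∀ r k → A t (r +ℕ k) k ≈ B r k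
  A≈B r k = begin
    A t (r +ℕ k) k
      ≈⟨ sum-filter (largestSingletonIs (suc k)) (partitions (suc (r +ℕ k))) ⟩
    sumL (largestWeight (suc k)) (partitions (suc r +ℕ k))
      ≈⟨ partitions-Ext (suc r) k (largestWeight (suc k)) ⟩
    sumL (λ π → Ext π (suc k) (suc r) (largestWeight (suc k))) (partitions k)
      ≈⟨ sumL-congAll (All.map (λ {π} → Ext-largest k r π) (Fine-partitions k)) ⟩
    sumL (λ π → t 1 * W π (suc k) r) (partitions k)
      ≈⟨ sumL-* (t 1) _ (partitions k) ⟩
    B r k ∎

  B-rec : ∀ r k → B (suc r) k ≈ B r (suc k) - t 1 * B r k
  B-rec r k = trans (*-congˡ (Q-rec r k)) (x[y-z]≈xy-xz (t 1) _ _)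

corollary2p7 : ∀ {c ℓ} (R : CommutativeRing c ℓ) (t : ℕ → CommutativeRing.Carrier R)
    (t₁⁻¹ : CommutativeRing.Carrier R) →
    CommutativeRing._≈_ R (CommutativeRing._*_ R (t 1) t₁⁻¹) (CommutativeRing.1# R) →
    (n m : ℕ) →
    let open CommutativeRing R
        open WithRing R
    in (sumTo n (λ k → pow (- 1#) (n ∸ k) * (nat· (n C k) (A t (n +ℕ m) (m +ℕ k))))
          ≈ Y t m * pow (t 1) (n +ℕ 1))
       × (sumTo n (λ k → nat· (n C k) (A t (m +ℕ k) m) * (pow (t 1) (n ∸ k) * t₁⁻¹))
          ≈ Y t (m +ℕ n))
corollary2p7 R t t₁⁻¹ t₁t₁⁻¹≈1 n m = alternatingIdentity , forwardIdentity
  where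
  open CommutativeRing R
  open WithRing R
  open import Relation.Binary.Reasoning.Setoid setoid
  open BinomialSums R
  open PartitionSums R t using (B; A≈B; B-rec)
  open Difference (t 1) B B-rec

  aboveDiagonal : ∀ {k} → k ≤ n → A t (n +ℕ m) (m +ℕ k) ≈ B (n ∸ k) (m +ℕ k)
  aboveDiagonal {k} k≤n = trans (≡⇒≈ (P.cong (λ z → A t z (m +ℕ k)) n+m≡)) (A≈B (n ∸ k) (m +ℕ k))
    where
    n+m≡ : n +ℕ m ≡ (n ∸ k) +ℕ (m +ℕ k)
    n+m≡ = P.trans (P.cong (_+ℕ m) (P.sym (ℕP.m∸n+n≡m k≤n)))
             (P.trans (ℕP.+-assoc (n ∸ k) k m) (P.cong ((n ∸ k) +ℕ_) (ℕP.+-comm k m)))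

  alternatingIdentity : sumTo n (λ k → pow (- 1#) (n ∸ k) * nat· (n C k) (A t (n +ℕ m) (m +ℕ k)))
                        ≈ Y t m * pow (t 1) (n +ℕ 1)
  alternatingIdentity = begin
    sumTo n (λ k → pow (- 1#) (n ∸ k) * nat· (n C k) (A t (n +ℕ m) (m +ℕ k)))
      ≈⟨ sumTo-cong n (λ k k≤n → *-congˡ (nat·-cong (n C k) (aboveDiagonal k≤n))) ⟩
    sumTo n (λ k → pow (- 1#) (n ∸ k) * nat· (n C k) (B (n ∸ k) (m +ℕ k)))
      ≈⟨ alternatingBinomial n m ⟩
    pow (t 1) n * (t 1 * Y t m)
      ≈⟨ trans (x∙yz≈y∙xz _ _ _) (trans (sym (*-assoc _ _ _)) (*-comm _ _)) ⟩
    Y t m * pow (t 1) (suc n)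
      ≡⟨ P.cong (λ z → Y t m * pow (t 1) z) (ℕP.+-comm 1 n) ⟩
    Y t m * pow (t 1) (n +ℕ 1) ∎

  forwardIdentity : sumTo n (λ k → nat· (n C k) (A t (m +ℕ k) m) * (pow (t 1) (n ∸ k) * t₁⁻¹))
                    ≈ Y t (m +ℕ n)
  forwardIdentity = begin
    sumTo n (λ k → nat· (n C k) (A t (m +ℕ k) m) * (pow (t 1) (n ∸ k) * t₁⁻¹))
      ≈⟨ sumTo-cong n (λ k _ → trans (sym (*-assoc _ _ _)) (*-congʳ (*-congʳ (nat·-cong (n C k)
           (trans (≡⇒≈ (P.cong (λ z → A t z m) (ℕP.+-comm m k))) (A≈B k m)))))) ⟩
    sumTo n (λ k → nat· (n C k) (B k m) * pow (t 1) (n ∸ k) * t₁⁻¹)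
      ≈⟨ sumTo-*ʳ n _ t₁⁻¹ ⟩
    sumTo n (λ k → nat· (n C k) (B k m) * pow (t 1) (n ∸ k)) * t₁⁻¹
      ≈⟨ *-congʳ (forwardBinomial n m) ⟩
    (t 1 * Y t (m +ℕ n)) * t₁⁻¹
      ≈⟨ trans (*-congʳ (*-comm _ _)) (trans (*-assoc _ _ _) (trans (*-congˡ t₁t₁⁻¹≈1) (*-identityʳ _))) ⟩
    Y t (m +ℕ n) ∎
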